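{- Let $p\ge 3$ be prime, let $\mathrm{Der}(p)$ be the set of derangements in $\mathrm{Sym}(p)$ (natural action on $[p]$), and let $D\subseteq\mathrm{Der}(p)$ be inverse-closed. If $\alpha(\mathrm{Cay}(\mathrm{Sym}(p),\mathrm{Der}(p)\setminus D))>(p-1)!$, then $D$ contains at least $(p-2)!$ labels, i.e. $|\{\{d,d^{ -1}\}:d\in D\}|\ge (p-2)!$.
   Context: A derangement is a permutation with no fixed point. For inverse-closed $S\subseteq G$ not containing the identity, $\mathrm{Cay}(G,S)$ is the graph on $G$ with $g,h$ adjacent iff $g^{ -1}h\in S$; $\alpha$ denotes independence number. -}

module Defs where

open import Data.Nat.Base using (ℕ)
open import Data.Bool.Base using (Bool; true; false; T)
open import Data.Fin.Base using (Fin)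
open import Data.Fin.Permutation
  using (Permutation′; _⟨$⟩ʳ_; _≈_; flip; _∘ₚ_)
open import Data.Product.Base using (_×_)
import Data.Product.Base
import Data.Nat.Base
open import Relation.Nullary using (¬_)
open import Relation.Binary.PropositionalEquality using (_≡_)

Sym : ℕ → Set
Sym n = Permutation′ n

Derangement : ∀ {n} → Sym n → Set
Derangement π = ∀ i → ¬ (π ⟨$⟩ʳ i ≡ i)

-- A subset of Sym(n), given by its (Boolean) characteristic function,
-- required to respect pointwise equality of permutations.
RespectsEq : ∀ {n} → (Sym n → Bool) → Set
RespectsEq {n} D = ∀ {π ρ : Sym n} → π ≈ ρ → T (D π) → T (D ρ)

-- The group product g⁻¹h as a function: x ↦ g⁻¹ (h x).
-- (_∘ₚ_ is diagrammatic: π ∘ₚ ρ applies π first.)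
_⁻¹·_ : ∀ {n} → Sym n → Sym n → Sym n
g ⁻¹· h = h ∘ₚ flip g

CayAdj : ∀ {n} → (Sym n → Set) → Sym n → Sym n → Set
CayAdj S g h = S (g ⁻¹· h)

DerMinus : ∀ {n} → (Sym n → Bool) → Sym n → Set
DerMinus D π = Derangement π × ¬ T (D π)

IndependentSet : ∀ {n} → (Sym n → Set) → (k : ℕ) → (Fin k → Sym n) → Set
IndependentSet S k f =
  ∀ i j → ¬ (i ≡ j) → ¬ (f i ≈ f j) × ¬ CayAdj S (f i) (f j)

IndepNumberGreaterThan : ∀ {n} → (Sym n → Set) → ℕ → Set
IndepNumberGreaterThan {n} S m =
  Data.Product.Base.Σ ℕ λ k → Data.Product.Base.Σ (Fin k → Sym n) λ f →
    (m Data.Nat.Base.< k) × IndependentSet S k f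

-- D contains at least m labels {d, d⁻¹}: there are m elements of D whose
-- labels are pairwise distinct.
AtLeastLabels : ∀ {n} → (Sym n → Bool) → ℕ → Set
AtLeastLabels {n} D m =
  Data.Product.Base.Σ (Fin m → Sym n) λ f →
    (∀ i → T (D (f i))) ×
    (∀ i j → ¬ (i ≡ j) → ¬ (f i ≈ f j) × ¬ (f i ≈ flip (f j)))

module Submission where

-- Let C be the group of translations t_e : x ↦ x + e of ℤ/p. For every τ, Sym(p) = Stab(0) · Cτ⁻¹
-- and |Stab(0)| = (p−1)!, so an independent set of more than (p−1)! permutations contains f ≠ f′
-- with f⁻¹f′ ∈ τCτ⁻¹ ∖ {1}. Such an element is a derangement, so independence forces it into D.
-- Letting τ range over the (p−2)! permutations fixing 0 and 1 gives elements τ t_e τ⁻¹ of D with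
-- distinct labels: if τ t_e τ⁻¹ = τ′ t_e′ τ′⁻¹ with e ≠ 0, then τ′⁻¹τ fixes 0 and 1 and carries
-- translations to translations, hence is the identity since e is invertible mod p; and the inverse
-- of τ′ t_e′ τ′⁻¹ is τ′ t_−e′ τ′⁻¹.

open import Defs
open import Data.Nat.Base using (ℕ; zero; suc; _+_; _*_; _<_; _≤_; _!; _∸_; _%_; s≤s; ≢-nonZero)
open import Data.Nat.Properties using (+-assoc; +-comm; *-assoc; *-identityʳ)
open import Data.Nat.DivMod
  using (_mod_; %-distribˡ-+; %-distribˡ-*; %-remove-+ˡ; m%n%n≡m%n; m%n<n; m<n⇒m%n≡m; [m+n]%n≡m%n; [m+kn]%n≡m%n)
open import Data.Nat.Divisibility using (m∣m*n; n∣m⇒m%n≡0)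
open import Data.Nat.Primality using (Prime)
open import Data.Nat.Coprimality using (prime⇒coprime; coprime-Bézout)
open import Data.Nat.GCD using (module Bézout)
open import Data.Nat.Tactic.RingSolver using (solve-∀)
open import Data.Bool.Base using (Bool; T)
open import Data.Fin.Base using (Fin; zero; suc; toℕ; combine; remQuot; punchIn)
open import Data.Fin.Properties
  using (toℕ-injective; toℕ-fromℕ<; toℕ<n; combine-injective; combine-remQuot; punchIn-injective; suc-injective; pigeonhole; <⇒≢)
open import Data.Fin.Permutation
  using (permutation; _⟨$⟩ʳ_; _⟨$⟩ˡ_; inverseˡ; inverseʳ; _≈_; id; flip; _∘ₚ_; remove; insert; lift₀;
         punchIn-permute; insert-punchIn; lift₀-remove; lift₀-cong)
open import Data.Product.Base using (∃; ∃₂; _×_; _,_; proj₁; proj₂)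
open import Level using (0ℓ)
open import Relation.Binary.Bundles using (Setoid)
import Relation.Binary.Reasoning.Setoid as SetoidReasoning
open import Relation.Nullary using (¬_)
open import Relation.Nullary.Decidable using (T?; decidable-stable)
open import Function.Base using (_∘_)
open import Relation.Binary.PropositionalEquality
  using (_≡_; _≢_; refl; sym; trans; cong; cong₂; module ≡-Reasoning)

encode : ∀ {n} → Sym n → Fin (n !)
encode {zero}  π = zero
encode {suc n} π = combine (π ⟨$⟩ʳ zero) (encode (remove zero π))

encode-injective : ∀ {n} (π ρ : Sym n) → encode π ≡ encode ρ → π ≈ ρ
encode-injective {suc n} π ρ eq = pointwise
  where
  open ≡-Reasoning
  split = combine-injective (π ⟨$⟩ʳ zero) (encode (remove zero π)) (ρ ⟨$⟩ʳ zero) (encode (remove zero ρ)) eq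
  tails : remove zero π ≈ remove zero ρ
  tails = encode-injective (remove zero π) (remove zero ρ) (proj₂ split)
  pointwise : π ≈ ρ
  pointwise zero    = proj₁ split
  pointwise (suc i) = begin
    π ⟨$⟩ʳ suc i                                  ≡⟨ punchIn-permute π zero i ⟩
    punchIn (π ⟨$⟩ʳ zero) (remove zero π ⟨$⟩ʳ i)  ≡⟨ cong₂ punchIn (proj₁ split) (tails i) ⟩
    punchIn (ρ ⟨$⟩ʳ zero) (remove zero ρ ⟨$⟩ʳ i)  ≡⟨ punchIn-permute ρ zero i ⟨
    ρ ⟨$⟩ʳ suc i                                  ∎

decode : ∀ {n} → Fin (n !) → Sym n
decode {zero}  _ = id
decode {suc n} x = insert zero (proj₁ (remQuot {suc n} (n !) x)) (decode (proj₂ (remQuot {suc n} (n !) x)))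

decode-injective : ∀ {n} (x y : Fin (n !)) → decode x ≈ decode y → x ≡ y
decode-injective {zero}  zero zero _ = refl
decode-injective {suc n} x y eq = begin
  x                                   ≡⟨ combine-remQuot {suc n} (n !) x ⟨
  combine (proj₁ qx) (proj₂ qx)       ≡⟨ cong₂ combine heads tails ⟩
  combine (proj₁ qy) (proj₂ qy)       ≡⟨ combine-remQuot {suc n} (n !) y ⟩
  y                                   ∎
  where
  open ≡-Reasoning
  qx qy : Fin (suc n) × Fin (n !)
  qx = remQuot {suc n} (n !) x
  qy = remQuot {suc n} (n !) y
  heads : proj₁ qx ≡ proj₁ qy
  heads = eq zero
  tails : proj₂ qx ≡ proj₂ qy
  tails = decode-injective {n} (proj₂ qx) (proj₂ qy) λ i → punchIn-injective (proj₁ qx) _ _ (begin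
    punchIn (proj₁ qx) (decode (proj₂ qx) ⟨$⟩ʳ i)  ≡⟨ insert-punchIn zero (proj₁ qx) (decode (proj₂ qx)) i ⟨
    decode x ⟨$⟩ʳ suc i                            ≡⟨ eq (suc i) ⟩
    decode y ⟨$⟩ʳ suc i                            ≡⟨ insert-punchIn zero (proj₁ qy) (decode (proj₂ qy)) i ⟩
    punchIn (proj₁ qy) (decode (proj₂ qy) ⟨$⟩ʳ i)  ≡⟨ cong (λ a → punchIn a (decode (proj₂ qy) ⟨$⟩ʳ i)) heads ⟨
    punchIn (proj₁ qx) (decode (proj₂ qy) ⟨$⟩ʳ i)  ∎)

remove-zero-injective : ∀ {n} (π ρ : Sym (suc n)) → π ⟨$⟩ʳ zero ≡ zero → ρ ⟨$⟩ʳ zero ≡ zero →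
                        remove zero π ≈ remove zero ρ → π ≈ ρ
remove-zero-injective π ρ π0 ρ0 eq x = begin
  π ⟨$⟩ʳ x                     ≡⟨ lift₀-remove π π0 x ⟨
  lift₀ (remove zero π) ⟨$⟩ʳ x ≡⟨ lift₀-cong _ _ eq x ⟩
  lift₀ (remove zero ρ) ⟨$⟩ʳ x ≡⟨ lift₀-remove ρ ρ0 x ⟩
  ρ ⟨$⟩ʳ x                     ∎
  where open ≡-Reasoning

conjugate : ∀ {n} → Sym n → Sym n → Sym n
conjugate τ π = flip τ ∘ₚ π ∘ₚ τ

conjugate-derangement : ∀ {n} (τ π : Sym n) → Derangement π → Derangement (conjugate τ π)
conjugate-derangement τ π der y fixed = der (τ ⟨$⟩ˡ y) (begin
  π ⟨$⟩ʳ (τ ⟨$⟩ˡ y)                      ≡⟨ inverseˡ τ ⟨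
  τ ⟨$⟩ˡ (τ ⟨$⟩ʳ (π ⟨$⟩ʳ (τ ⟨$⟩ˡ y)))   ≡⟨ cong (τ ⟨$⟩ˡ_) fixed ⟩
  τ ⟨$⟩ˡ y                               ∎)
  where open ≡-Reasoning

conjugate-id : ∀ {n} (τ π : Sym n) → π ≈ id → conjugate τ π ≈ id
conjugate-id τ π π≈id y = trans (cong (τ ⟨$⟩ʳ_) (π≈id (τ ⟨$⟩ˡ y))) (inverseʳ τ)

⁻¹·-id : ∀ {n} (g h : Sym n) → g ⁻¹· h ≈ id → g ≈ h
⁻¹·-id g h g⁻¹h≈id y = begin
  g ⟨$⟩ʳ y                      ≡⟨ cong (g ⟨$⟩ʳ_) (g⁻¹h≈id y) ⟨
  g ⟨$⟩ʳ (g ⟨$⟩ˡ (h ⟨$⟩ʳ y))    ≡⟨ inverseʳ g ⟩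
  h ⟨$⟩ʳ y                      ∎
  where open ≡-Reasoning

-- Fin (suc m) as ℤ/(suc m), with −a represented by m * a.
module Translations (m : ℕ) where

  P : ℕ
  P = suc m

  -- A record rather than a synonym for a % P ≡ b % P, so that a and b stay inferable.
  infix 4 _≋_
  record _≋_ (a b : ℕ) : Set where
    constructor mod-≡
    field %-≡ : a % P ≡ b % P

  ≋-refl : ∀ {a} → a ≋ a
  ≋-refl = mod-≡ refl

  ≋-sym : ∀ {a b} → a ≋ b → b ≋ a
  ≋-sym (mod-≡ h) = mod-≡ (sym h)

  ≋-trans : ∀ {a b c} → a ≋ b → b ≋ c → a ≋ c
  ≋-trans (mod-≡ h) (mod-≡ k) = mod-≡ (trans h k)

  ≋-setoid : Setoid 0ℓ 0ℓ
  ≋-setoid = record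
    { Carrier       = ℕ
    ; _≈_           = _≋_
    ; isEquivalence = record { refl = ≋-refl ; sym = ≋-sym ; trans = ≋-trans }
    }

  module ≋-Reasoning = SetoidReasoning ≋-setoid

  ≡⇒≋ : ∀ {a b} → a ≡ b → a ≋ b
  ≡⇒≋ refl = ≋-refl

  %-≋ : ∀ a → a % P ≋ a
  %-≋ a = mod-≡ (m%n%n≡m%n a P)

  ≋-+ʳ : ∀ {a b} c → a ≋ b → a + c ≋ b + c
  ≋-+ʳ {a} {b} c (mod-≡ h) = mod-≡ (begin
    (a + c) % P             ≡⟨ %-distribˡ-+ a c P ⟩
    (a % P + c % P) % P     ≡⟨ cong (λ u → (u + c % P) % P) h ⟩
    (b % P + c % P) % P     ≡⟨ %-distribˡ-+ b c P ⟨
    (b + c) % P             ∎)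
    where open ≡-Reasoning

  ≋-+ˡ : ∀ c {a b} → a ≋ b → c + a ≋ c + b
  ≋-+ˡ c {a} {b} h = ≋-trans (≡⇒≋ (+-comm c a)) (≋-trans (≋-+ʳ c h) (≡⇒≋ (+-comm b c)))

  ≋-*ˡ : ∀ c {a b} → a ≋ b → c * a ≋ c * b
  ≋-*ˡ c {a} {b} (mod-≡ h) = mod-≡ (begin
    (c * a) % P             ≡⟨ %-distribˡ-* c a P ⟩
    (c % P * (a % P)) % P   ≡⟨ cong (λ u → (c % P * u) % P) h ⟩
    (c % P * (b % P)) % P   ≡⟨ %-distribˡ-* c b P ⟨
    (c * b) % P             ∎)
    where open ≡-Reasoning

  multiple-≋ : ∀ c a → P * c + a ≋ a
  multiple-≋ c a = mod-≡ (%-remove-+ˡ a (m∣m*n c))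

  negate-inverse : ∀ a → a + m * a ≋ 0
  negate-inverse a = mod-≡ (n∣m⇒m%n≡0 (P * a) P (m∣m*n a))

  +-cancelˡ-≋ : ∀ c {a b} → c + a ≋ c + b → a ≋ b
  +-cancelˡ-≋ c {a} {b} h = begin
    a                  ≈⟨ multiple-≋ c a ⟨
    P * c + a          ≡⟨ regroup a ⟩
    m * c + (c + a)    ≈⟨ ≋-+ˡ (m * c) h ⟩
    m * c + (c + b)    ≡⟨ regroup b ⟨
    P * c + b          ≈⟨ multiple-≋ c b ⟩
    b                  ∎
    where
    open ≋-Reasoning
    regroup : ∀ x → P * c + x ≡ m * c + (c + x)
    regroup x = trans (cong (_+ x) (+-comm c (m * c))) (+-assoc (m * c) c x)

  toℕ-mod : ∀ a → toℕ (a mod P) ≡ a % P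
  toℕ-mod a = toℕ-fromℕ< (m%n<n a P)

  mod-cong : ∀ {a b} → a ≋ b → a mod P ≡ b mod P
  mod-cong {a} {b} (mod-≡ h) = toℕ-injective (trans (toℕ-mod a) (trans h (sym (toℕ-mod b))))

  mod-injective : ∀ {a b} → a mod P ≡ b mod P → a ≋ b
  mod-injective {a} {b} h = mod-≡ (trans (sym (toℕ-mod a)) (trans (cong toℕ h) (toℕ-mod b)))

  toℕ-mod-inverse : ∀ (x : Fin P) → toℕ x mod P ≡ x
  toℕ-mod-inverse x = toℕ-injective (trans (toℕ-mod (toℕ x)) (m<n⇒m%n≡m (toℕ<n x)))

  infixl 6 _⊕_
  _⊕_ : Fin P → ℕ → Fin P
  x ⊕ a = (toℕ x + a) mod P

  ⊕-cong : ∀ x {a b} → a ≋ b → x ⊕ a ≡ x ⊕ b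
  ⊕-cong x h = mod-cong (≋-+ˡ (toℕ x) h)

  ⊕-cancel : ∀ x {a b} → x ⊕ a ≡ x ⊕ b → a ≋ b
  ⊕-cancel x h = +-cancelˡ-≋ (toℕ x) (mod-injective h)

  ⊕-identityʳ : ∀ x → x ⊕ 0 ≡ x
  ⊕-identityʳ x = trans (cong (_mod P) (+-comm (toℕ x) 0)) (toℕ-mod-inverse x)

  ⊕-assoc : ∀ x a b → x ⊕ a ⊕ b ≡ x ⊕ (a + b)
  ⊕-assoc x a b = mod-cong (begin
    toℕ (x ⊕ a) + b          ≡⟨ cong (_+ b) (toℕ-mod (toℕ x + a)) ⟩
    (toℕ x + a) % P + b      ≈⟨ ≋-+ʳ b (%-≋ (toℕ x + a)) ⟩
    toℕ x + a + b            ≡⟨ +-assoc (toℕ x) a b ⟩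
    toℕ x + (a + b)          ∎)
    where open ≋-Reasoning

  ⊕-negate : ∀ x a → x ⊕ a ⊕ m * a ≡ x
  ⊕-negate x a = trans (⊕-assoc x a (m * a)) (trans (⊕-cong x (negate-inverse a)) (⊕-identityʳ x))

  negate-⊕ : ∀ x a → x ⊕ m * a ⊕ a ≡ x
  negate-⊕ x a = trans (⊕-assoc x (m * a) a)
    (trans (⊕-cong x (≋-trans (≡⇒≋ (+-comm (m * a) a)) (negate-inverse a))) (⊕-identityʳ x))

  shift : ℕ → Sym P
  shift a = permutation (_⊕ a) (_⊕ m * a) (λ x → negate-⊕ x a) (λ x → ⊕-negate x a)

  shift-derangement : ∀ {a} → ¬ (a ≋ 0) → Derangement (shift a)
  shift-derangement a≉0 x fixed = a≉0 (⊕-cancel x (trans fixed (sym (⊕-identityʳ x))))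

  shift-id : ∀ {a} → a ≋ 0 → shift a ≈ id
  shift-id a≋0 x = trans (⊕-cong x a≋0) (⊕-identityʳ x)

  mod-inverse : Prime P → ∀ {a} → ¬ (a ≋ 0) → ∃ λ k → k * a ≋ 1
  mod-inverse P-prime {a} a≉0 = from-Bézout (coprime-Bézout coprime)
    where
    expand : ∀ n y r → n * y * r + suc n ≡ 1 + n * (1 + y * r)
    expand = solve-∀
    r : ℕ
    r = a % P
    instance _ = ≢-nonZero (λ r≡0 → a≉0 (mod-≡ r≡0))
    coprime = prime⇒coprime P-prime (m%n<n a P)
    a≋r : a ≋ r
    a≋r = ≋-sym (%-≋ a)
    from-Bézout : Bézout.Identity 1 P r → ∃ λ k → k * a ≋ 1
    from-Bézout (Bézout.-+ x y eq) = y , (begin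
      y * a          ≈⟨ ≋-*ˡ y a≋r ⟩
      y * r          ≡⟨ eq ⟨
      1 + x * P      ≈⟨ mod-≡ ([m+kn]%n≡m%n 1 x P) ⟩
      1              ∎)
      where open ≋-Reasoning
    from-Bézout (Bézout.+- x y eq) = m * y , (begin
      m * y * a              ≈⟨ ≋-*ˡ (m * y) a≋r ⟩
      m * y * r              ≈⟨ mod-≡ ([m+n]%n≡m%n (m * y * r) P) ⟨
      m * y * r + P          ≡⟨ expand m y r ⟩
      1 + m * (1 + y * r)    ≡⟨ cong (λ u → 1 + m * u) eq ⟩
      1 + m * (x * P)        ≡⟨ cong (1 +_) (*-assoc m x P) ⟨
      1 + m * x * P          ≈⟨ mod-≡ ([m+kn]%n≡m%n 1 (m * x) P) ⟩
      1                      ∎)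
      where open ≋-Reasoning

  -- σ is determined on the multiples of e, and these exhaust Fin P because e is invertible.
  intertwiner-fixing-0-1-is-id : Prime P → (σ : Fin P → Fin P) {e c : ℕ} →
    σ zero ≡ zero → σ (1 mod P) ≡ 1 mod P → ¬ (e ≋ 0) →
    (∀ x → σ (x ⊕ e) ≡ σ x ⊕ c) → ∀ x → σ x ≡ x
  intertwiner-fixing-0-1-is-id P-prime σ {e} {c} σ0 σ1 e≉0 intertwines x = begin
    σ x                        ≡⟨ cong σ (toℕ-mod-inverse x) ⟨
    σ (X mod P)                ≡⟨ cong σ (mod-cong (scale-by-inverse k*e≋1)) ⟨
    σ ((X * k * e) mod P)      ≡⟨ on-multiples (X * k) ⟩
    (X * k * c) mod P          ≡⟨ mod-cong (scale-by-inverse k*c≋1) ⟩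
    X mod P                    ≡⟨ toℕ-mod-inverse x ⟩
    x                          ∎
    where
    open ≡-Reasoning
    X : ℕ
    X = toℕ x
    on-multiples : ∀ j → σ ((j * e) mod P) ≡ (j * c) mod P
    on-multiples zero    = σ0
    on-multiples (suc j) = begin
      σ ((e + j * e) mod P)        ≡⟨ cong σ (trans (⊕-assoc zero (j * e) e) (cong (_mod P) (+-comm (j * e) e))) ⟨
      σ ((j * e) mod P ⊕ e)        ≡⟨ intertwines ((j * e) mod P) ⟩
      σ ((j * e) mod P) ⊕ c        ≡⟨ cong (_⊕ c) (on-multiples j) ⟩
      (j * c) mod P ⊕ c            ≡⟨ ⊕-assoc zero (j * c) c ⟩
      (j * c + c) mod P            ≡⟨ cong (_mod P) (+-comm (j * c) c) ⟩
      (c + j * c) mod P            ∎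
    k : ℕ
    k = proj₁ (mod-inverse P-prime e≉0)
    k*e≋1 : k * e ≋ 1
    k*e≋1 = proj₂ (mod-inverse P-prime e≉0)
    k*c≋1 : k * c ≋ 1
    k*c≋1 = mod-injective (trans (sym (on-multiples k)) (trans (cong σ (mod-cong k*e≋1)) σ1))
    scale-by-inverse : ∀ {a} → k * a ≋ 1 → X * k * a ≋ X
    scale-by-inverse {a} k*a≋1 =
      ≋-trans (≡⇒≋ (*-assoc X k a)) (≋-trans (≋-*ˡ X k*a≋1) (≡⇒≋ (*-identityʳ X)))

  conjugate-shift-injective : Prime P → (τ τ′ : Sym P) {e : ℕ} (e′ : ℕ) →
    τ ⟨$⟩ʳ zero ≡ zero → τ ⟨$⟩ʳ (1 mod P) ≡ 1 mod P →
    τ′ ⟨$⟩ʳ zero ≡ zero → τ′ ⟨$⟩ʳ (1 mod P) ≡ 1 mod P →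
    ¬ (e ≋ 0) → conjugate τ (shift e) ≈ conjugate τ′ (shift e′) → τ ≈ τ′
  conjugate-shift-injective P-prime τ τ′ {e} e′ τ0 τ1 τ′0 τ′1 e≉0 same x = begin
    τ ⟨$⟩ʳ x                  ≡⟨ inverseʳ τ′ ⟨
    τ′ ⟨$⟩ʳ σ x               ≡⟨ cong (τ′ ⟨$⟩ʳ_) (σ-id x) ⟩
    τ′ ⟨$⟩ʳ x                 ∎
    where
    open ≡-Reasoning
    σ : Fin P → Fin P
    σ x = τ′ ⟨$⟩ˡ (τ ⟨$⟩ʳ x)
    inverse-fixes : ∀ {y} → τ′ ⟨$⟩ʳ y ≡ y → τ ⟨$⟩ʳ y ≡ y → σ y ≡ y
    inverse-fixes {y} τ′y τy = trans (cong (τ′ ⟨$⟩ˡ_) (trans τy (sym τ′y))) (inverseˡ τ′)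
    intertwines : ∀ x → σ (x ⊕ e) ≡ σ x ⊕ e′
    intertwines x = begin
      τ′ ⟨$⟩ˡ (τ ⟨$⟩ʳ (x ⊕ e))                              ≡⟨ cong (λ w → τ′ ⟨$⟩ˡ (τ ⟨$⟩ʳ (w ⊕ e))) (inverseˡ τ) ⟨
      τ′ ⟨$⟩ˡ (conjugate τ (shift e) ⟨$⟩ʳ (τ ⟨$⟩ʳ x))       ≡⟨ cong (τ′ ⟨$⟩ˡ_) (same (τ ⟨$⟩ʳ x)) ⟩
      τ′ ⟨$⟩ˡ (conjugate τ′ (shift e′) ⟨$⟩ʳ (τ ⟨$⟩ʳ x))     ≡⟨ inverseˡ τ′ ⟩
      σ x ⊕ e′                                              ∎
    σ-id : ∀ x → σ x ≡ x
    σ-id = intertwiner-fixing-0-1-is-id P-prime σ (inverse-fixes τ′0 τ0) (inverse-fixes τ′1 τ1) e≉0 intertwines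

  -- Sym P = Stab(0) · C τ⁻¹ for the translation group C, and Stab(0) has only m ! elements.
  collision : ∀ {k} (τ : Sym P) (f : Fin k → Sym P) → m ! < k →
    ∃₂ λ i j → i ≢ j × ∃ λ e → f i ⁻¹· f j ≈ conjugate τ (shift e)
  collision {k} τ f m!<k = i , j , <⇒≢ i<j , m * c j + c i , f-i⁻¹f-j
    where
    c : Fin k → ℕ
    c a = toℕ (τ ⟨$⟩ˡ (f a ⟨$⟩ˡ zero))
    s : Fin k → Sym P
    s a = shift (c a) ∘ₚ τ ∘ₚ f a
    s-fixes-zero : ∀ a → s a ⟨$⟩ʳ zero ≡ zero
    s-fixes-zero a = begin
      f a ⟨$⟩ʳ (τ ⟨$⟩ʳ (c a mod P))                      ≡⟨ cong (λ w → f a ⟨$⟩ʳ (τ ⟨$⟩ʳ w)) (toℕ-mod-inverse _) ⟩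
      f a ⟨$⟩ʳ (τ ⟨$⟩ʳ (τ ⟨$⟩ˡ (f a ⟨$⟩ˡ zero)))          ≡⟨ cong (f a ⟨$⟩ʳ_) (inverseʳ τ) ⟩
      f a ⟨$⟩ʳ (f a ⟨$⟩ˡ zero)                           ≡⟨ inverseʳ (f a) ⟩
      zero                                              ∎
      where open ≡-Reasoning
    pigeon = pigeonhole m!<k (λ a → encode (remove zero (s a)))
    i j : Fin k
    i = proj₁ pigeon
    j = proj₁ (proj₂ pigeon)
    i<j = proj₁ (proj₂ (proj₂ pigeon))
    s-i≈s-j : s i ≈ s j
    s-i≈s-j = remove-zero-injective (s i) (s j) (s-fixes-zero i) (s-fixes-zero j)
      (encode-injective (remove zero (s i)) (remove zero (s j)) (proj₂ (proj₂ (proj₂ pigeon))))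
    f-i⁻¹f-j : f i ⁻¹· f j ≈ conjugate τ (shift (m * c j + c i))
    f-i⁻¹f-j y = begin
      f i ⟨$⟩ˡ (f j ⟨$⟩ʳ y)                   ≡⟨ cong (λ w → f i ⟨$⟩ˡ (f j ⟨$⟩ʳ w)) y≡ ⟩
      f i ⟨$⟩ˡ (s j ⟨$⟩ʳ x)                   ≡⟨ cong (f i ⟨$⟩ˡ_) (s-i≈s-j x) ⟨
      f i ⟨$⟩ˡ (f i ⟨$⟩ʳ (τ ⟨$⟩ʳ (x ⊕ c i)))  ≡⟨ inverseˡ (f i) ⟩
      τ ⟨$⟩ʳ (x ⊕ c i)                        ≡⟨ cong (τ ⟨$⟩ʳ_) (⊕-assoc z (m * c j) (c i)) ⟩
      τ ⟨$⟩ʳ (z ⊕ (m * c j + c i))            ∎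
      where
      open ≡-Reasoning
      z = τ ⟨$⟩ˡ y
      x = z ⊕ m * c j
      y≡ : y ≡ τ ⟨$⟩ʳ (x ⊕ c j)
      y≡ = trans (sym (inverseʳ τ)) (cong (τ ⟨$⟩ʳ_) (sym (negate-⊕ z (c j))))

  independent-set-meets-conjugates : (D : Sym P → Bool) → RespectsEq D →
    ∀ {k} (f : Fin k → Sym P) → m ! < k → IndependentSet (DerMinus D) k f →
    (τ : Sym P) → ∃ λ e → ¬ (e ≋ 0) × T (D (conjugate τ (shift e)))
  independent-set-meets-conjugates D D-resp f m!<k independent τ =
    meets (collision τ f m!<k)
    where
    meets : (∃₂ λ i j → i ≢ j × ∃ λ e → f i ⁻¹· f j ≈ conjugate τ (shift e)) →
            ∃ λ e → ¬ (e ≋ 0) × T (D (conjugate τ (shift e)))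
    meets (i , j , i≢j , e , same) = e , e≉0 , D-resp same d∈D
      where
      e≉0 : ¬ (e ≋ 0)
      e≉0 e≋0 = proj₁ (independent i j i≢j)
        (⁻¹·-id (f i) (f j) λ y → trans (same y) (conjugate-id τ (shift e) (shift-id e≋0) y))
      derangement : Derangement (f i ⁻¹· f j)
      derangement y fixed = conjugate-derangement τ (shift e) (shift-derangement e≉0) y (trans (sym (same y)) fixed)
      d∈D : T (D (f i ⁻¹· f j))
      d∈D = decidable-stable (T? _) λ d∉D → proj₂ (independent i j i≢j) (derangement , d∉D)

lemma5p4 : (p : ℕ) → Prime p → 3 ≤ p →
    (D : Sym p → Bool) → RespectsEq D →
    (∀ π → T (D π) → Derangement π) →
    (∀ π → T (D π) → T (D (flip π))) →
    IndepNumberGreaterThan (DerMinus D) ((p ∸ 1) !) →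
    AtLeastLabels D ((p ∸ 2) !)
lemma5p4 (suc (suc zero)) _ (s≤s (s≤s ()))
lemma5p4 (suc (suc (suc r))) p-prime _ D D-resp _ _ (k , f , m!<k , independent) =
  label , (λ t → proj₂ (proj₂ (meets t))) , distinct
  where
  open Translations (suc (suc r))
  τ : Fin (suc r !) → Sym P
  τ t = lift₀ (lift₀ (decode t))
  τ-injective : ∀ t t′ → τ t ≈ τ t′ → t ≡ t′
  τ-injective t t′ same = decode-injective t t′ λ i → suc-injective (suc-injective (same (suc (suc i))))
  meets : ∀ t → ∃ λ e → ¬ (e ≋ 0) × T (D (conjugate (τ t) (shift e)))
  meets = independent-set-meets-conjugates D D-resp f m!<k independent ∘ τ
  e : Fin (suc r !) → ℕ
  e t = proj₁ (meets t)
  label : Fin (suc r !) → Sym P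
  label t = conjugate (τ t) (shift (e t))
  label-determines-index : ∀ t t′ e′ → label t ≈ conjugate (τ t′) (shift e′) → t ≡ t′
  label-determines-index t t′ e′ same =
    τ-injective t t′ (conjugate-shift-injective p-prime (τ t) (τ t′) e′ refl refl refl refl (proj₁ (proj₂ (meets t))) same)
  distinct : ∀ t t′ → t ≢ t′ → ¬ (label t ≈ label t′) × ¬ (label t ≈ flip (label t′))
  distinct t t′ t≢t′ = (t≢t′ ∘ label-determines-index t t′ (e t′))
                     , (t≢t′ ∘ label-determines-index t t′ (suc (suc r) * e t′))
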